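{- Let $G$ be an $n\times n$ layered grid graph, let $k$ be a positive integer dividing $n$, and let $H$ be the auxiliary graph defined below. Then every directed path $u=x_1,x_2,\dots,x_r=v$ in $H$ (with distinct vertices $x_1,\dots,x_r$) has length at most $2k+1$, i.e. $r-1\le 2k+1$.
   Context: A layered grid graph $G$ has vertices $(i,j)$, $0\le i,j\le n$, every edge joining vertices at $L_1$-distance one and directed north ($(i,j)\to(i,j+1)$) or east ($(i,j)\to(i+1,j)$). For $i\in[k+1]$ let $L_h(i)=\{(i',j'): j'=(i-1)\tfrac nk\}$ and $L_v(i)=\{(i',j'): i'=(i-1)\tfrac nk\}$ (gridlines). For integers $0\le a,b<k$, the block with index $l=ak+b+1$ is the subgraph $G_l$ of $G$ induced by the vertices $(i,j)$ with $a\tfrac nk\le i\le (a+1)\tfrac nk$ and $b\tfrac nk\le j\le (b+1)\tfrac nk$. The auxiliary graph $H$ has vertex set $V(H)=\{(i,j): i \text{ or } j \text{ is a non-negative multiple of } n/k\}$. Its edges are: (1) for every block $G_l$ and every pair $u,v\in V(G_l)\cap V(H)$ such that $u,v$ do not both lie in a common $L_v(i)$ and do not both lie in a common $L_h(i)$, the edge $(u,v)$ is present iff there is a directed path from $u$ to $v$ in $G_l$; (2) for every block $G_l$ and every pair $u=(i_1,j_1),v=(i_2,j_2)\in V(G_l)$ with either $j_1=j'\tfrac nk$, $j_2=(j'+1)\tfrac nk$ for some $j'$, or $i_1=i'\tfrac nk$, $i_2=(i'+1)\tfrac nk$ for some $i'$, the edge $(u,v)$ is present iff there is a directed path from $u$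 to $v$ in $G_l$. No other edges are present. -}

module Defs where

open import Data.Nat using (ℕ; zero; suc; _+_; _*_; _≤_; _<_)
open import Data.Product using (Σ; ∃; ∃-syntax; _×_; _,_; proj₁; proj₂)
open import Data.Sum using (_⊎_)
open import Relation.Nullary using (¬_)
open import Relation.Binary.PropositionalEquality using (_≡_)

Vertex : Set
Vertex = ℕ × ℕ

-- A layered grid graph on the (n+1)×(n+1) grid: a subset of the
-- north edges (i,j)→(i,j+1) and east edges (i,j)→(i+1,j).
-- north i j  : the edge (i,j)→(i,j+1) is present
-- east  i j  : the edge (i,j)→(i+1,j) is present
-- (values outside the grid are irrelevant: paths below are confined to blocks
--  lying inside the grid.)
record LayeredGrid (n : ℕ) : Set₁ where
  field
    north : ℕ → ℕ → Set
    east  : ℕ → ℕ → Set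
open LayeredGrid public

IsMult : ℕ → ℕ → Set
IsMult m x = ∃[ t ] x ≡ t * m

InBlock : ℕ → ℕ → ℕ → Vertex → Set
InBlock m a b (i , j) = (a * m ≤ i × i ≤ suc a * m) × (b * m ≤ j × j ≤ suc b * m)

-- directed path inside the block G_l (l = a k + b + 1) from u to v
data Reach {n : ℕ} (G : LayeredGrid n) (m a b : ℕ) : Vertex → Vertex → Set where
  here  : ∀ {u} → Reach G m a b u u
  stepN : ∀ {i j v} → north G i j → InBlock m a b (i , suc j) →
          Reach G m a b (i , suc j) v → Reach G m a b (i , j) v
  stepE : ∀ {i j v} → east G i j → InBlock m a b (suc i , j) →
          Reach G m a b (suc i , j) v → Reach G m a b (i , j) v

InVH : ℕ → ℕ → Vertex → Set
InVH n m (i , j) = (i ≤ n × j ≤ n) × (IsMult m i ⊎ IsMult m j)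

Type1 : ℕ → ℕ → Vertex → Vertex → Set
Type1 n m u v =
  InVH n m u × InVH n m v ×
  ¬ (proj₁ u ≡ proj₁ v × IsMult m (proj₁ u)) ×
  ¬ (proj₂ u ≡ proj₂ v × IsMult m (proj₂ u))

Type2 : ℕ → Vertex → Vertex → Set
Type2 m u v =
  (∃[ j' ] (proj₂ u ≡ j' * m × proj₂ v ≡ suc j' * m)) ⊎
  (∃[ i' ] (proj₁ u ≡ i' * m × proj₁ v ≡ suc i' * m))

-- edges of the auxiliary graph H (block side m = n/k, k×k blocks)
HEdge : {n : ℕ} → LayeredGrid n → (k m : ℕ) → Vertex → Vertex → Set
HEdge {n} G k m u v =
  ∃[ a ] ∃[ b ] (a < k × b < k ×
    InBlock m a b u × InBlock m a b v ×
    (Type1 n m u v ⊎ Type2 m u v) ×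
    Reach G m a b u v)

module Submission where

-- Let m = n/k be the block side and level (i , j) = ⌊i/m⌋ + ⌊j/m⌋.  An edge of H
-- lies in one block and follows a monotone path, so the level never decreases
-- along it; it cannot stay constant either, since the endpoints would then be
-- two distinct gridline vertices of the same block on a common gridline, which
-- neither edge type allows.  The level of a vertex of the grid is at most 2k, so
-- a path in H visits at most 2k + 1 vertices.

open import Defs
open import Data.Nat using (ℕ; zero; suc; _+_; _*_; _≤_; _<_; _/_; NonZero; z≤n; s≤s)
open import Data.Nat.Properties
open import Data.Nat.DivMod using (m≡m%n+[m/n]*n; m*n/n≡m; m/n*n≡m; /-monoˡ-≤)
open import Data.Nat.Divisibility using (_∣_)
open import Data.List using (List; length; []; _∷_)
open import Data.List.Relation.Unary.All as All using (All; []; _∷_)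
open import Data.List.Relation.Unary.Unique.Propositional using (Unique)
open import Data.List.Relation.Unary.AllPairs using (_∷_)
open import Data.List.Relation.Unary.Linked using (Linked; _∷_)
open import Data.Product using (_×_; _,_)
open import Data.Sum using (_⊎_; inj₁; inj₂)
open import Relation.Nullary using (¬_; contradiction)
open import Relation.Binary.PropositionalEquality

module _ {A : Set} {R : A → A → Set} (f : A → ℕ) (B : ℕ)
         (f-increasing : ∀ {x y} → R x y → f x < f y) where

  Linked-potential+length≤ : ∀ x xs → All (λ z → f z ≤ B) (x ∷ xs) →
                             Linked R (x ∷ xs) → f x + length xs ≤ B
  Linked-potential+length≤ x []       (fx≤B ∷ []) _                = ≤-trans (≤-reflexive (+-identityʳ (f x))) fx≤B
  Linked-potential+length≤ x (y ∷ ys) (_ ∷ bounded) (xRy ∷ linked) = begin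
    f x + suc (length ys) ≡⟨ +-suc (f x) (length ys) ⟩
    suc (f x) + length ys ≤⟨ +-monoˡ-≤ (length ys) (f-increasing xRy) ⟩
    f y + length ys       ≤⟨ Linked-potential+length≤ y ys bounded linked ⟩
    B                     ∎
    where open ≤-Reasoning

  Linked-length≤ : ∀ xs → All (λ z → f z ≤ B) xs → Linked R xs → length xs ≤ suc B
  Linked-length≤ []       _       _      = z≤n
  Linked-length≤ (x ∷ xs) bounded linked =
    s≤s (≤-trans (m≤n+m (length xs) (f x)) (Linked-potential+length≤ x xs bounded linked))

Unique-constant-length≤1 : {A : Set} {c : A} (xs : List A) →
                           All (_≡ c) xs → Unique xs → length xs ≤ 1
Unique-constant-length≤1 []          _                  _                = z≤n
Unique-constant-length≤1 (_ ∷ [])    _                  _                = s≤s z≤n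
Unique-constant-length≤1 (_ ∷ _ ∷ _) (refl ∷ refl ∷ _) ((x≢y ∷ _) ∷ _) = contradiction refl x≢y

+-mono-≤-unless-≡ : ∀ {a a′ b b′} → a ≤ a′ → b ≤ b′ → ¬ (a ≡ a′ × b ≡ b′) → a + b < a′ + b′
+-mono-≤-unless-≡ a≤ b≤ ¬both with m≤n⇒m<n∨m≡n a≤ | m≤n⇒m<n∨m≡n b≤
... | inj₁ a< | _       = +-mono-<-≤ a< b≤
... | inj₂ _  | inj₁ b< = +-mono-≤-< a≤ b<
... | inj₂ a≡ | inj₂ b≡ = contradiction (a≡ , b≡) ¬both

Reach-monotone : ∀ {n} {G : LayeredGrid n} {m a b i₁ j₁ i₂ j₂} →
                 Reach G m a b (i₁ , j₁) (i₂ , j₂) → i₁ ≤ i₂ × j₁ ≤ j₂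
Reach-monotone here = ≤-refl , ≤-refl
Reach-monotone (stepN _ _ path) with i≤ , j≤ ← Reach-monotone path = i≤ , m+n≤o⇒n≤o 1 j≤
Reach-monotone (stepE _ _ path) with i≤ , j≤ ← Reach-monotone path = m+n≤o⇒n≤o 1 i≤ , j≤

module BlockSide (m : ℕ) .{{_ : NonZero m}} where

  level : Vertex → ℕ
  level (i , j) = i / m + j / m

  /-of-multiple : ∀ {x} t → x ≡ t * m → x / m ≡ t
  /-of-multiple t refl = m*n/n≡m t m

  -- y = t m is the least number with quotient t.
  multiple-≤-same-quotient⇒≡ : ∀ {x y} → x ≤ y → x / m ≡ y / m → IsMult m y → x ≡ y
  multiple-≤-same-quotient⇒≡ {x} x≤y x/m≡y/m (t , refl) = ≤-antisym x≤y (begin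
    t * m           ≡⟨ cong (_* m) (sym (m*n/n≡m t m)) ⟩
    (t * m / m) * m ≡⟨ cong (_* m) (sym x/m≡y/m) ⟩
    (x / m) * m     ≤⟨ m≤n+m _ _ ⟩
    _               ≡⟨ sym (m≡m%n+[m/n]*n x m) ⟩
    x               ∎)
    where open ≤-Reasoning

  SameBlockLevel : Vertex → Vertex → Set
  SameBlockLevel (i₁ , j₁) (i₂ , j₂) = i₁ / m ≡ i₂ / m × j₁ / m ≡ j₂ / m

  Type1⇒¬SameBlockLevel : ∀ {n i₁ j₁ i₂ j₂} → Type1 n m (i₁ , j₁) (i₂ , j₂) →
                          i₁ ≤ i₂ → j₁ ≤ j₂ → ¬ SameBlockLevel (i₁ , j₁) (i₂ , j₂)
  Type1⇒¬SameBlockLevel (_ , (_ , inj₁ i₂-mult) , ¬vertical , _) i≤ _ (i-eq , _)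
    with refl ← multiple-≤-same-quotient⇒≡ i≤ i-eq i₂-mult = ¬vertical (refl , i₂-mult)
  Type1⇒¬SameBlockLevel (_ , (_ , inj₂ j₂-mult) , _ , ¬horizontal) _ j≤ (_ , j-eq)
    with refl ← multiple-≤-same-quotient⇒≡ j≤ j-eq j₂-mult = ¬horizontal (refl , j₂-mult)

  Type2⇒¬SameBlockLevel : ∀ {u v} → Type2 m u v → ¬ SameBlockLevel u v
  Type2⇒¬SameBlockLevel (inj₁ (t , j₁≡ , j₂≡)) (_ , j-eq) =
    1+n≢n (trans (sym (/-of-multiple (suc t) j₂≡)) (trans (sym j-eq) (/-of-multiple t j₁≡)))
  Type2⇒¬SameBlockLevel (inj₂ (t , i₁≡ , i₂≡)) (i-eq , _) =
    1+n≢n (trans (sym (/-of-multiple (suc t) i₂≡)) (trans (sym i-eq) (/-of-multiple t i₁≡)))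

  HEdge⇒level< : ∀ {n k} {G : LayeredGrid n} {u v} → HEdge G k m u v → level u < level v
  HEdge⇒level< {n} {u = u@(_ , _)} {v = v@(_ , _)} (_ , _ , _ , _ , _ , _ , type , path)
    with i≤ , j≤ ← Reach-monotone path =
    +-mono-≤-unless-≡ (/-monoˡ-≤ m i≤) (/-monoˡ-≤ m j≤) (¬same type)
    where
    ¬same : Type1 n m u v ⊎ Type2 m u v → ¬ SameBlockLevel u v
    ¬same (inj₁ type1) = Type1⇒¬SameBlockLevel type1 i≤ j≤
    ¬same (inj₂ type2) = Type2⇒¬SameBlockLevel type2

  level≤ : ∀ {n k v} → n ≤ k * m → InVH n m v → level v ≤ 2 * k
  level≤ {n} {k} {i , j} n≤km ((i≤n , j≤n) , _) = begin
    i / m + j / m ≤⟨ +-mono-≤ (quotient≤ i≤n) (quotient≤ j≤n) ⟩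
    k + k         ≡⟨ cong (k +_) (sym (+-identityʳ k)) ⟩
    2 * k         ∎
    where
    open ≤-Reasoning
    quotient≤ : ∀ {x} → x ≤ n → x / m ≤ k
    quotient≤ x≤n = ≤-trans (/-monoˡ-≤ m (≤-trans x≤n n≤km)) (≤-reflexive (m*n/n≡m k m))

path-length≤ : (n k m : ℕ) → m * k ≡ n → (G : LayeredGrid n) →
               (xs : List Vertex) → All (InVH n m) xs → Unique xs →
               Linked (HEdge G k m) xs → length xs ≤ suc (2 * k + 1)
path-length≤ .0 k zero refl G xs inVH unique _ =
  ≤-trans (Unique-constant-length≤1 xs (All.map origin inVH) unique) (s≤s z≤n)
  where
  origin : ∀ {v} → InVH 0 0 v → v ≡ (0 , 0)
  origin ((z≤n , z≤n) , _) = refl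
path-length≤ n k m@(suc _) mk≡n G xs inVH _ linked =
  ≤-trans (Linked-length≤ level (2 * k) HEdge⇒level< xs levels linked)
          (s≤s (m≤m+n (2 * k) 1))
  where
  open BlockSide m
  levels : All (λ v → level v ≤ 2 * k) xs
  levels = All.map (level≤ {k = k} (≤-reflexive (trans (sym mk≡n) (*-comm m k)))) inVH

lemma2 : (n k : ℕ) → .{{_ : NonZero k}} → k ∣ n → (G : LayeredGrid n) →
         (xs : List Vertex) → All (InVH n (n / k)) xs → Unique xs →
         Linked (HEdge G k (n / k)) xs →
         length xs ≤ suc (2 * k + 1)
lemma2 n k k∣n = path-length≤ n k (n / k) (m/n*n≡m k∣n)
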